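{- Let $x$ be a formal variable. For integers $q\ge 1$ and $0<j_1<j_2<\dots<j_q$, define the rational function $$N(x;j_1,\dots,j_q):=(-12)^q\, j_1 j_2\cdots j_q\,\frac{j_1(j_2-j_1)\cdots(j_q-j_{q-1})(x-j_q)}{\prod_{i=1}^{q}\left(x^3-x+j_i-j_i^3\right)}.$$ For each integer $p\ge 2$ let $$A_p(x):=\sum_{q=1}^{p-1}\ \sum_{0<j_1<\dots<j_q<p} N(x;j_1,\dots,j_q),$$ the sum over all nonempty subsets $\{j_1<\dots<j_q\}$ of $\{1,\dots,p-1\}$. Then, as rational functions of $x$, $$A_p(x)=\frac{p(p-1)\left(3p^2-4xp-3p+2x\right)}{x(x-1)(x+1)}.$$ Consequently, substituting $x=p$, one has $A_p(p)=-p$ for every integer $p\ge2$.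
   Context: The sequence $(j_1,\dots,j_q)$ is written in increasing order; for $q=1$ the product $j_1(j_2-j_1)\cdots(j_q-j_{q-1})(x-j_q)$ is just $j_1(x-j_1)$. -}

module Defs where

open import Data.Nat as ℕ using (ℕ; zero; suc; _∸_)
open import Data.Integer using (+_)
open import Data.Rational using (ℚ; _+_; _*_; _-_; -_; 0ℚ; 1ℚ; 1/_; _/_; ≢-nonZero)
open import Data.Rational.Properties using (_≟_)
open import Data.List using (List; []; _∷_; map; _++_; foldr; applyUpTo; length)
open import Relation.Nullary using (yes; no)

⟦_⟧ : ℕ → ℚ
⟦ n ⟧ = + n / 1

-- total inverse (convention 1/0 = 0; only ever used away from poles)
inv : ℚ → ℚ
inv q with q ≟ 0ℚ
... | yes _ = 0ℚ
... | no q≢0 = 1/_ q {{≢-nonZero q≢0}}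

sumℚ : List ℚ → ℚ
sumℚ = foldr _+_ 0ℚ

prodℚ : List ℚ → ℚ
prodℚ = foldr _*_ 1ℚ

_^ℚ_ : ℚ → ℕ → ℚ
a ^ℚ zero = 1ℚ
a ^ℚ suc n = a * (a ^ℚ n)

cubicFactor : ℚ → ℕ → ℚ
cubicFactor x j = x * x * x - x + ⟦ j ⟧ - ⟦ j ⟧ * ⟦ j ⟧ * ⟦ j ⟧

diffProd : ℚ → ℕ → List ℕ → ℚ
diffProd x prev [] = x - ⟦ prev ⟧
diffProd x prev (j ∷ js) = (⟦ j ⟧ - ⟦ prev ⟧) * diffProd x j js

N : ℚ → List ℕ → ℚ
N x js =
  (- ⟦ 12 ⟧) ^ℚ length js * prodℚ (map ⟦_⟧ js) * diffProd x 0 js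
    * inv (prodℚ (map (cubicFactor x) js))

subs : List ℕ → List (List ℕ)
subs [] = [] ∷ []
subs (a ∷ as) = map (a ∷_) (subs as) ++ subs as

neSubs : List ℕ → List (List ℕ)
neSubs [] = []
neSubs (a ∷ as) = map (a ∷_) (subs as) ++ neSubs as

range1 : ℕ → List ℕ
range1 p = applyUpTo suc (p ∸ 1)

A : ℕ → ℚ → ℚ
A p x = sumℚ (map (N x) (neSubs (range1 p)))

RHS : ℕ → ℚ → ℚ
RHS p x =
  ⟦ p ⟧ * (⟦ p ⟧ - 1ℚ)
    * (⟦ 3 ⟧ * ⟦ p ⟧ * ⟦ p ⟧ - ⟦ 4 ⟧ * x * ⟦ p ⟧ - ⟦ 3 ⟧ * ⟦ p ⟧ + ⟦ 2 ⟧ * x)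
    * inv (x * (x - 1ℚ) * (x + 1ℚ))

-- Put w j = −12 j / c_x(j), where c_x(j) = x³ − x + j − j³, so that N(x; j₁,…,j_q) is
-- w j₁ ⋯ w j_q times the telescoping product j₁(j₂ − j₁)⋯(x − j_q). Replace the final x
-- of that product by a free y and let H_m(y) be the sum over all subsets of {1,…,m},
-- the empty one included. The subset S ∪ {m} contributes w m (y − m) times the term of S
-- with y replaced by m, so H_m(y) = H_{m−1}(y) + w m (y − m) H_{m−1}(m). By induction,
-- H_m(y) = y − 12 Σ_{k≤m} k²(y − k) / (x³ − x): the induction goes through because
-- H_{m−1}(m) = m c_x(m) / (x³ − x), and this cancels the pole of w m. Then
-- A_p(x) = H_{p−1}(x) − x, and summing the squares and cubes gives the closed form.
-- At x = p every c_p(j) = (p − j)(p² + pj + j² − 1) with j < p is nonzero.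
module Submission where

open import Defs
open import Data.Nat as ℕ using (ℕ; zero; suc; _≥_; _<_; s≤s; z≤n)
import Data.Nat.Properties as ℕP
open import Data.Nat.Coprimality using (1-coprimeTo) renaming (sym to coprime-sym)
open import Data.Integer as ℤ using (+_)
import Data.Integer.Properties as ℤP
open import Data.Rational using (ℚ; _+_; _-_; _*_; -_; 0ℚ; 1ℚ; mkℚ; ↥_; _/_; ≢-nonZero)
import Data.Rational.Properties as ℚP
open import Data.Rational.Solver using (module +-*-Solver)
open +-*-Solver using (Polynomial; solve; _:=_; con; _:+_; _:*_; _:-_; :-_)
open import Data.List using (List; []; _∷_; _++_; _∷ʳ_; map; applyUpTo; length)
open import Data.List.Properties using (map-++; map-cong; map-∘; ++-assoc; applyUpTo-∷ʳ)
open import Data.List.Membership.Propositional using (_∈_)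
open import Data.List.Membership.Propositional.Properties using (∈-applyUpTo⁻)
open import Data.List.Relation.Unary.All using (All; tabulate)
open import Data.List.Relation.Unary.All.Properties using (∷ʳ⁻)
open import Data.Product using (_×_; _,_; proj₁; proj₂)
open import Function using (_∘_)
open import Relation.Binary.PropositionalEquality
  using (_≡_; _≢_; refl; sym; trans; cong; cong₂; subst; module ≡-Reasoning)
open import Relation.Nullary using (Dec; yes; no; contradiction)
open ≡-Reasoning

⟦⟧≡mkℚ : ∀ n → ⟦ n ⟧ ≡ mkℚ (+ n) 0 (coprime-sym (1-coprimeTo n))
⟦⟧≡mkℚ n = ℚP.normalize-coprime (coprime-sym (1-coprimeTo n))

⟦⟧-injective : ∀ {m n} → ⟦ m ⟧ ≡ ⟦ n ⟧ → m ≡ n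
⟦⟧-injective {m} {n} eq =
  ℤP.+-injective (cong ↥_ (trans (sym (⟦⟧≡mkℚ m)) (trans eq (⟦⟧≡mkℚ n))))

⟦suc⟧ : ∀ n → ⟦ suc n ⟧ ≡ ⟦ n ⟧ + 1ℚ
⟦suc⟧ n rewrite ⟦⟧≡mkℚ n =
  cong (_/ 1) (trans (cong +_ (ℕP.+-comm 1 n)) (cong (ℤ._+ + 1) (sym (ℤP.*-identityʳ (+ n)))))

⟦⟧-homo-+ : ∀ m n → ⟦ m ℕ.+ n ⟧ ≡ ⟦ m ⟧ + ⟦ n ⟧
⟦⟧-homo-+ zero    n = sym (ℚP.+-identityˡ ⟦ n ⟧)
⟦⟧-homo-+ (suc m) n = begin
  ⟦ suc (m ℕ.+ n) ⟧    ≡⟨ ⟦suc⟧ (m ℕ.+ n) ⟩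
  ⟦ m ℕ.+ n ⟧ + 1ℚ     ≡⟨ cong (_+ 1ℚ) (⟦⟧-homo-+ m n) ⟩
  ⟦ m ⟧ + ⟦ n ⟧ + 1ℚ   ≡⟨ solve 2 (λ m n → m :+ n :+ con 1ℚ := (m :+ con 1ℚ) :+ n) refl ⟦ m ⟧ ⟦ n ⟧ ⟩
  (⟦ m ⟧ + 1ℚ) + ⟦ n ⟧ ≡⟨ cong (_+ ⟦ n ⟧) (sym (⟦suc⟧ m)) ⟩
  ⟦ suc m ⟧ + ⟦ n ⟧    ∎

⟦⟧-homo-* : ∀ m n → ⟦ m ℕ.* n ⟧ ≡ ⟦ m ⟧ * ⟦ n ⟧
⟦⟧-homo-* zero    n = sym (ℚP.*-zeroˡ ⟦ n ⟧)
⟦⟧-homo-* (suc m) n = begin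
  ⟦ n ℕ.+ m ℕ.* n ⟧      ≡⟨ ⟦⟧-homo-+ n (m ℕ.* n) ⟩
  ⟦ n ⟧ + ⟦ m ℕ.* n ⟧    ≡⟨ cong (_+_ ⟦ n ⟧) (⟦⟧-homo-* m n) ⟩
  ⟦ n ⟧ + ⟦ m ⟧ * ⟦ n ⟧  ≡⟨ solve 2 (λ m n → n :+ m :* n := (m :+ con 1ℚ) :* n) refl ⟦ m ⟧ ⟦ n ⟧ ⟩
  (⟦ m ⟧ + 1ℚ) * ⟦ n ⟧   ≡⟨ cong (_* ⟦ n ⟧) (sym (⟦suc⟧ m)) ⟩
  ⟦ suc m ⟧ * ⟦ n ⟧      ∎

p-q≡0⇒p≡q : ∀ p q → p - q ≡ 0ℚ → p ≡ q
p-q≡0⇒p≡q p q p-q≡0 = begin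
  p             ≡⟨ solve 2 (λ p q → p := (p :- q) :+ q) refl p q ⟩
  (p - q) + q   ≡⟨ cong (_+ q) p-q≡0 ⟩
  0ℚ + q        ≡⟨ ℚP.+-identityˡ q ⟩
  q             ∎

⟦m⟧-⟦n⟧≢0 : ∀ {m n} → m ≢ n → ⟦ m ⟧ - ⟦ n ⟧ ≢ 0ℚ
⟦m⟧-⟦n⟧≢0 m≢n eq = m≢n (⟦⟧-injective (p-q≡0⇒p≡q _ _ eq))

inv-inverseˡ : ∀ a → a ≢ 0ℚ → inv a * a ≡ 1ℚ
inv-inverseˡ a a≢0 with a ℚP.≟ 0ℚ
... | yes a≡0 = contradiction a≡0 a≢0
... | no  _   = ℚP.*-inverseˡ a {{≢-nonZero a≢0}}

inv-unique : ∀ a b → b * a ≡ 1ℚ → inv a ≡ b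
inv-unique a b ba≡1 = begin
  inv a             ≡⟨ sym (ℚP.*-identityʳ (inv a)) ⟩
  inv a * 1ℚ        ≡⟨ cong (inv a *_) (sym ba≡1) ⟩
  inv a * (b * a)   ≡⟨ solve 3 (λ i a b → i :* (b :* a) := b :* (i :* a)) refl (inv a) a b ⟩
  b * (inv a * a)   ≡⟨ cong (b *_) (inv-inverseˡ a a≢0) ⟩
  b * 1ℚ            ≡⟨ ℚP.*-identityʳ b ⟩
  b                 ∎
  where
  a≢0 : a ≢ 0ℚ
  a≢0 refl = ℚP.1≢0 (trans (sym ba≡1) (ℚP.*-zeroʳ b))

inv-*-inverse : ∀ a b → a ≢ 0ℚ → b ≢ 0ℚ → (inv a * inv b) * (a * b) ≡ 1ℚ
inv-*-inverse a b a≢0 b≢0 = begin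
  (inv a * inv b) * (a * b)
    ≡⟨ solve 4 (λ i j a b → (i :* j) :* (a :* b) := (i :* a) :* (j :* b)) refl (inv a) (inv b) a b ⟩
  (inv a * a) * (inv b * b)
    ≡⟨ cong₂ _*_ (inv-inverseˡ a a≢0) (inv-inverseˡ b b≢0) ⟩
  1ℚ ∎

*-≢0 : ∀ {a b} → a ≢ 0ℚ → b ≢ 0ℚ → a * b ≢ 0ℚ
*-≢0 {a} {b} a≢0 b≢0 ab≡0 = ℚP.1≢0 (begin
  1ℚ                          ≡⟨ sym (inv-*-inverse a b a≢0 b≢0) ⟩
  (inv a * inv b) * (a * b)   ≡⟨ cong (inv a * inv b *_) ab≡0 ⟩
  (inv a * inv b) * 0ℚ        ≡⟨ ℚP.*-zeroʳ (inv a * inv b) ⟩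
  0ℚ                          ∎)

inv-distrib-* : ∀ a b → inv (a * b) ≡ inv a * inv b
inv-distrib-* a b = by-cases (a ℚP.≟ 0ℚ) (b ℚP.≟ 0ℚ)
  where
  by-cases : Dec (a ≡ 0ℚ) → Dec (b ≡ 0ℚ) → inv (a * b) ≡ inv a * inv b
  by-cases (yes a≡0) _ = subst (λ a → inv (a * b) ≡ inv a * inv b) (sym a≡0)
    (trans (cong inv (ℚP.*-zeroˡ b)) (sym (ℚP.*-zeroˡ (inv b))))
  by-cases (no _)   (yes b≡0) = subst (λ b → inv (a * b) ≡ inv a * inv b) (sym b≡0)
    (trans (cong inv (ℚP.*-zeroʳ a)) (sym (ℚP.*-zeroʳ (inv a))))
  by-cases (no a≢0) (no b≢0) = inv-unique (a * b) (inv a * inv b) (inv-*-inverse a b a≢0 b≢0)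

sumℚ-++ : ∀ xs ys → sumℚ (xs ++ ys) ≡ sumℚ xs + sumℚ ys
sumℚ-++ []       ys = sym (ℚP.+-identityˡ (sumℚ ys))
sumℚ-++ (x ∷ xs) ys =
  trans (cong (_+_ x) (sumℚ-++ xs ys)) (sym (ℚP.+-assoc x (sumℚ xs) (sumℚ ys)))

sumℚ-*ˡ : ∀ k xs → sumℚ (map (k *_) xs) ≡ k * sumℚ xs
sumℚ-*ˡ k []       = sym (ℚP.*-zeroʳ k)
sumℚ-*ˡ k (x ∷ xs) =
  trans (cong (_+_ (k * x)) (sumℚ-*ˡ k xs)) (sym (ℚP.*-distribˡ-+ k x (sumℚ xs)))

subs≡neSubs∷ʳ[] : ∀ xs → subs xs ≡ neSubs xs ∷ʳ []
subs≡neSubs∷ʳ[] []       = refl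
subs≡neSubs∷ʳ[] (x ∷ xs) =
  trans (cong (map (x ∷_) (subs xs) ++_) (subs≡neSubs∷ʳ[] xs))
        (sym (++-assoc (map (x ∷_) (subs xs)) (neSubs xs) ([] ∷ [])))

sumℚ-subs : ∀ (f : List ℕ → ℚ) xs →
  sumℚ (map f (subs xs)) ≡ sumℚ (map f (neSubs xs)) + f []
sumℚ-subs f xs = begin
  sumℚ (map f (subs xs))                  ≡⟨ cong (sumℚ ∘ map f) (subs≡neSubs∷ʳ[] xs) ⟩
  sumℚ (map f (neSubs xs ∷ʳ []))          ≡⟨ cong sumℚ (map-++ f (neSubs xs) ([] ∷ [])) ⟩
  sumℚ (map f (neSubs xs) ∷ʳ f [])        ≡⟨ sumℚ-++ (map f (neSubs xs)) (f [] ∷ []) ⟩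
  sumℚ (map f (neSubs xs)) + (f [] + 0ℚ)
    ≡⟨ cong (_+_ (sumℚ (map f (neSubs xs)))) (ℚP.+-identityʳ (f [])) ⟩
  sumℚ (map f (neSubs xs)) + f []         ∎

weightedTerm : (ℕ → ℚ) → ℚ → ℕ → List ℕ → ℚ
weightedTerm w y j₀ js = prodℚ (map w js) * diffProd y j₀ js

subsetSum : (ℕ → ℚ) → ℚ → ℕ → List ℕ → ℚ
subsetSum w y j₀ xs = sumℚ (map (weightedTerm w y j₀) (subs xs))

weightedTerm-∷ : ∀ w y j₀ j js →
  weightedTerm w y j₀ (j ∷ js) ≡ w j * (⟦ j ⟧ - ⟦ j₀ ⟧) * weightedTerm w y j js
weightedTerm-∷ w y j₀ j js =
  solve 4 (λ wj P d D → (wj :* P) :* (d :* D) := wj :* d :* (P :* D)) refl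
    (w j) (prodℚ (map w js)) (⟦ j ⟧ - ⟦ j₀ ⟧) (diffProd y j js)

subsetSum-∷ : ∀ w y j₀ j xs →
  subsetSum w y j₀ (j ∷ xs) ≡ w j * (⟦ j ⟧ - ⟦ j₀ ⟧) * subsetSum w y j xs + subsetSum w y j₀ xs
subsetSum-∷ w y j₀ j xs = begin
  sumℚ (map T (map (j ∷_) S ++ S))
    ≡⟨ cong sumℚ (map-++ T (map (j ∷_) S) S) ⟩
  sumℚ (map T (map (j ∷_) S) ++ map T S)
    ≡⟨ sumℚ-++ (map T (map (j ∷_) S)) (map T S) ⟩
  sumℚ (map T (map (j ∷_) S)) + sumℚ (map T S)
    ≡⟨ cong (_+ sumℚ (map T S)) containing-j ⟩
  k * subsetSum w y j xs + subsetSum w y j₀ xs ∎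
  where
  T = weightedTerm w y j₀
  S = subs xs
  k = w j * (⟦ j ⟧ - ⟦ j₀ ⟧)
  containing-j : sumℚ (map T (map (j ∷_) S)) ≡ k * subsetSum w y j xs
  containing-j = begin
    sumℚ (map T (map (j ∷_) S))                     ≡⟨ cong sumℚ (sym (map-∘ S)) ⟩
    sumℚ (map (T ∘ (j ∷_)) S)                       ≡⟨ cong sumℚ (map-cong (weightedTerm-∷ w y j₀ j) S) ⟩
    sumℚ (map ((k *_) ∘ weightedTerm w y j) S)      ≡⟨ cong sumℚ (map-∘ S) ⟩
    sumℚ (map (k *_) (map (weightedTerm w y j) S))  ≡⟨ sumℚ-*ˡ k (map (weightedTerm w y j) S) ⟩
    k * subsetSum w y j xs                          ∎

subsetSum-∷ʳ : ∀ w y j₀ xs j →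
  subsetSum w y j₀ (xs ∷ʳ j) ≡ subsetSum w y j₀ xs + w j * (y - ⟦ j ⟧) * subsetSum w ⟦ j ⟧ j₀ xs
subsetSum-∷ʳ w y j₀ [] j =
  solve 5 (λ wj J J₀ y one →
      (wj :* one) :* ((J :- J₀) :* (y :- J)) :+ (one :* (y :- J₀) :+ con 0ℚ)
    := (one :* (y :- J₀) :+ con 0ℚ) :+ wj :* (y :- J) :* (one :* (J :- J₀) :+ con 0ℚ))
    refl (w j) ⟦ j ⟧ ⟦ j₀ ⟧ y 1ℚ
subsetSum-∷ʳ w y j₀ (i ∷ xs) j = begin
  subsetSum w y j₀ (i ∷ xs ∷ʳ j)
    ≡⟨ subsetSum-∷ w y j₀ i (xs ∷ʳ j) ⟩
  k * subsetSum w y i (xs ∷ʳ j) + subsetSum w y j₀ (xs ∷ʳ j)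
    ≡⟨ cong₂ (λ s t → k * s + t) (subsetSum-∷ʳ w y i xs j) (subsetSum-∷ʳ w y j₀ xs j) ⟩
  k * (H y i + c * H J i) + (H y j₀ + c * H J j₀)
    ≡⟨ solve 6 (λ k c a b d e → k :* (a :+ c :* b) :+ (d :+ c :* e) := (k :* a :+ d) :+ c :* (k :* b :+ e))
         refl k c (H y i) (H J i) (H y j₀) (H J j₀) ⟩
  (k * H y i + H y j₀) + c * (k * H J i + H J j₀)
    ≡⟨ sym (cong₂ (λ s t → s + c * t) (subsetSum-∷ w y j₀ i xs) (subsetSum-∷ w J j₀ i xs)) ⟩
  subsetSum w y j₀ (i ∷ xs) + c * subsetSum w J j₀ (i ∷ xs) ∎
  where
  J = ⟦ j ⟧
  k = w i * (⟦ i ⟧ - ⟦ j₀ ⟧)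
  c = w j * (y - J)
  H : ℚ → ℕ → ℚ
  H z i₀ = subsetSum w z i₀ xs

cubic : ℚ → ℚ
cubic x = x * (x - 1ℚ) * (x + 1ℚ)

cubicᴾ : ∀ {n} → Polynomial n → Polynomial n
cubicᴾ x = x :* (x :- con 1ℚ) :* (x :+ con 1ℚ)

cubicFactor≡cubic-cubic : ∀ x j → cubicFactor x j ≡ cubic x - cubic ⟦ j ⟧
cubicFactor≡cubic-cubic x j =
  solve 2 (λ x J → x :* x :* x :- x :+ J :- J :* J :* J := cubicᴾ x :- cubicᴾ J) refl x ⟦ j ⟧

weight : ℚ → ℕ → ℚ
weight x j = - ⟦ 12 ⟧ * ⟦ j ⟧ * inv (cubicFactor x j)

weight-*-cubicFactor : ∀ x j → cubicFactor x j ≢ 0ℚ →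
  weight x j * cubicFactor x j ≡ - ⟦ 12 ⟧ * ⟦ j ⟧
weight-*-cubicFactor x j c≢0 = begin
  - ⟦ 12 ⟧ * ⟦ j ⟧ * inv c * c
    ≡⟨ solve 3 (λ k i c → k :* i :* c := k :* (i :* c)) refl (- ⟦ 12 ⟧ * ⟦ j ⟧) (inv c) c ⟩
  - ⟦ 12 ⟧ * ⟦ j ⟧ * (inv c * c)
    ≡⟨ cong (- ⟦ 12 ⟧ * ⟦ j ⟧ *_) (inv-inverseˡ c c≢0) ⟩
  - ⟦ 12 ⟧ * ⟦ j ⟧ * 1ℚ
    ≡⟨ ℚP.*-identityʳ _ ⟩
  - ⟦ 12 ⟧ * ⟦ j ⟧ ∎
  where c = cubicFactor x j

prodℚ-weight : ∀ x js →
  (- ⟦ 12 ⟧) ^ℚ length js * prodℚ (map ⟦_⟧ js) * inv (prodℚ (map (cubicFactor x) js))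
    ≡ prodℚ (map (weight x) js)
prodℚ-weight x []       = refl
prodℚ-weight x (j ∷ js) = begin
  (m * G) * (⟦ j ⟧ * P) * inv (cubicFactor x j * C)
    ≡⟨ cong ((m * G) * (⟦ j ⟧ * P) *_) (inv-distrib-* (cubicFactor x j) C) ⟩
  (m * G) * (⟦ j ⟧ * P) * (inv (cubicFactor x j) * inv C)
    ≡⟨ solve 6 (λ m G J P i I → (m :* G) :* (J :* P) :* (i :* I) := (m :* J :* i) :* (G :* P :* I))
         refl m G ⟦ j ⟧ P (inv (cubicFactor x j)) (inv C) ⟩
  weight x j * (G * P * inv C)
    ≡⟨ cong (weight x j *_) (prodℚ-weight x js) ⟩
  weight x j * prodℚ (map (weight x) js) ∎
  where
  m = - ⟦ 12 ⟧
  G = m ^ℚ length js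
  P = prodℚ (map ⟦_⟧ js)
  C = prodℚ (map (cubicFactor x) js)

N≡weightedTerm : ∀ x js → N x js ≡ weightedTerm (weight x) x 0 js
N≡weightedTerm x js = begin
  F * D * I   ≡⟨ solve 3 (λ F D I → F :* D :* I := F :* I :* D) refl F D I ⟩
  F * I * D   ≡⟨ cong (_* D) (prodℚ-weight x js) ⟩
  weightedTerm (weight x) x 0 js ∎
  where
  F = (- ⟦ 12 ⟧) ^ℚ length js * prodℚ (map ⟦_⟧ js)
  D = diffProd x 0 js
  I = inv (prodℚ (map (cubicFactor x) js))

A≡subsetSum-x : ∀ p x → A p x ≡ subsetSum (weight x) x 0 (range1 p) - x
A≡subsetSum-x p x = begin
  sumℚ (map (N x) (neSubs xs))     ≡⟨ cong sumℚ (map-cong (N≡weightedTerm x) (neSubs xs)) ⟩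
  S                                ≡⟨ solve 2 (λ S x → S := (S :+ con 1ℚ :* (x :- con 0ℚ)) :- x) refl S x ⟩
  (S + T []) - x                   ≡⟨ cong (_- x) (sym (sumℚ-subs T xs)) ⟩
  subsetSum (weight x) x 0 xs - x  ∎
  where
  xs = range1 p
  T = weightedTerm (weight x) x 0
  S = sumℚ (map T (neSubs xs))

-- y − 12 e Σ_{k=1}^{M} k² (y − k), by Σ k² = M(M+1)(2M+1)/6 and Σ k³ = M²(M+1)²/4.
closedForm : ℚ → ℚ → ℚ → ℚ
closedForm e M y = y - e * M * (M + 1ℚ) * (⟦ 2 ⟧ * (⟦ 2 ⟧ * M + 1ℚ) * y - ⟦ 3 ⟧ * M * (M + 1ℚ))

closedFormᴾ : ∀ {n} → Polynomial n → Polynomial n → Polynomial n → Polynomial n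
closedFormᴾ e M y =
  y :- e :* M :* (M :+ con 1ℚ)
        :* (con ⟦ 2 ⟧ :* (con ⟦ 2 ⟧ :* M :+ con 1ℚ) :* y :- con ⟦ 3 ⟧ :* M :* (M :+ con 1ℚ))

closedForm-suc : ∀ e m y →
  closedForm e ⟦ m ⟧ y + - ⟦ 12 ⟧ * ⟦ suc m ⟧ * (⟦ suc m ⟧ * e * (y - ⟦ suc m ⟧))
    ≡ closedForm e ⟦ suc m ⟧ y
closedForm-suc e m y rewrite ⟦suc⟧ m =
  solve 3 (λ e M y → let B = M :+ con 1ℚ in
      closedFormᴾ e M y :+ :- con ⟦ 12 ⟧ :* B :* (B :* e :* (y :- B)) := closedFormᴾ e B y)
    refl e ⟦ m ⟧ y

closedForm-at-suc : ∀ e m →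
  closedForm e ⟦ m ⟧ ⟦ suc m ⟧ ≡ ⟦ suc m ⟧ * (1ℚ - e * cubic ⟦ suc m ⟧)
closedForm-at-suc e m rewrite ⟦suc⟧ m =
  solve 2 (λ e M → let B = M :+ con 1ℚ in closedFormᴾ e M B := B :* (con 1ℚ :- e :* cubicᴾ B))
    refl e ⟦ m ⟧

closedForm-at-pole : ∀ x e → e * cubic x ≡ 1ℚ → ∀ m →
  closedForm e ⟦ m ⟧ ⟦ suc m ⟧ ≡ ⟦ suc m ⟧ * e * cubicFactor x (suc m)
closedForm-at-pole x e e*cx≡1 m = begin
  closedForm e ⟦ m ⟧ B             ≡⟨ closedForm-at-suc e m ⟩
  B * (1ℚ - e * cubic B)           ≡⟨ cong (λ t → B * (t - e * cubic B)) (sym e*cx≡1) ⟩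
  B * (e * cubic x - e * cubic B)
    ≡⟨ solve 4 (λ B e X Y → B :* (e :* X :- e :* Y) := B :* e :* (X :- Y)) refl B e (cubic x) (cubic B) ⟩
  B * e * (cubic x - cubic B)      ≡⟨ cong (B * e *_) (sym (cubicFactor≡cubic-cubic x (suc m))) ⟩
  B * e * cubicFactor x (suc m)    ∎
  where B = ⟦ suc m ⟧

subsetSum-closedForm : ∀ x e → e * cubic x ≡ 1ℚ →
  ∀ m → All (λ j → cubicFactor x j ≢ 0ℚ) (applyUpTo suc m) →
  ∀ y → subsetSum (weight x) y 0 (applyUpTo suc m) ≡ closedForm e ⟦ m ⟧ y
subsetSum-closedForm x e e*cx≡1 zero    _  y =
  solve 2 (λ e y → con 1ℚ :* (y :- con 0ℚ) :+ con 0ℚ := closedFormᴾ e (con 0ℚ) y) refl e y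
subsetSum-closedForm x e e*cx≡1 (suc m) nz y = begin
  subsetSum w y 0 (applyUpTo suc (suc m))
    ≡⟨ cong (subsetSum w y 0) (sym (applyUpTo-∷ʳ suc m)) ⟩
  subsetSum w y 0 (js ∷ʳ suc m)
    ≡⟨ subsetSum-∷ʳ w y 0 js (suc m) ⟩
  subsetSum w y 0 js + w (suc m) * (y - B) * subsetSum w B 0 js
    ≡⟨ cong₂ (λ s t → s + w (suc m) * (y - B) * t) (IH y) (IH B) ⟩
  Φ y + w (suc m) * (y - B) * Φ B
    ≡⟨ cong (λ t → Φ y + w (suc m) * (y - B) * t) (closedForm-at-pole x e e*cx≡1 m) ⟩
  Φ y + w (suc m) * (y - B) * (B * e * c)
    ≡⟨ cong (_+_ (Φ y)) regroup ⟩
  Φ y + w (suc m) * c * (B * e * (y - B))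
    ≡⟨ cong (λ t → Φ y + t * (B * e * (y - B))) (weight-*-cubicFactor x (suc m) c≢0) ⟩
  Φ y + - ⟦ 12 ⟧ * B * (B * e * (y - B))
    ≡⟨ closedForm-suc e m y ⟩
  closedForm e B y ∎
  where
  w = weight x
  js = applyUpTo suc m
  B = ⟦ suc m ⟧
  c = cubicFactor x (suc m)
  Φ = closedForm e ⟦ m ⟧
  nz′ = ∷ʳ⁻ (subst (All (λ j → cubicFactor x j ≢ 0ℚ)) (sym (applyUpTo-∷ʳ suc m)) nz)
  c≢0 = proj₂ nz′
  IH = subsetSum-closedForm x e e*cx≡1 m (proj₁ nz′)
  regroup : w (suc m) * (y - B) * (B * e * c) ≡ w (suc m) * c * (B * e * (y - B))
  regroup = solve 5 (λ w y B e c → w :* (y :- B) :* (B :* e :* c) := w :* c :* (B :* e :* (y :- B)))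
              refl (w (suc m)) y B e c

closedForm-x≡RHS : ∀ n x → closedForm (inv (cubic x)) ⟦ n ⟧ x - x ≡ RHS (suc n) x
closedForm-x≡RHS n x = begin
  closedForm e ⟦ n ⟧ x - x
    ≡⟨ solve 3 (λ e M x → closedFormᴾ e M x :- x := RHSᴾ (M :+ con 1ℚ) x e) refl e ⟦ n ⟧ x ⟩
  rhs (⟦ n ⟧ + 1ℚ)
    ≡⟨ cong rhs (sym (⟦suc⟧ n)) ⟩
  RHS (suc n) x ∎
  where
  e = inv (cubic x)
  rhs : ℚ → ℚ
  rhs P = P * (P - 1ℚ) * (⟦ 3 ⟧ * P * P - ⟦ 4 ⟧ * x * P - ⟦ 3 ⟧ * P + ⟦ 2 ⟧ * x) * e
  RHSᴾ : ∀ {k} → Polynomial k → Polynomial k → Polynomial k → Polynomial k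
  RHSᴾ P x e =
    P :* (P :- con 1ℚ) :* (con ⟦ 3 ⟧ :* P :* P :- con ⟦ 4 ⟧ :* x :* P :- con ⟦ 3 ⟧ :* P :+ con ⟦ 2 ⟧ :* x) :* e

A≡RHS : ∀ n x → cubic x ≢ 0ℚ → (∀ j → j ∈ range1 (suc n) → cubicFactor x j ≢ 0ℚ) →
  A (suc n) x ≡ RHS (suc n) x
A≡RHS n x cx≢0 nz = begin
  A (suc n) x
    ≡⟨ A≡subsetSum-x (suc n) x ⟩
  subsetSum (weight x) x 0 (applyUpTo suc n) - x
    ≡⟨ cong (_- x) (subsetSum-closedForm x e (inv-inverseˡ (cubic x) cx≢0) n (tabulate (nz _)) x) ⟩
  closedForm e ⟦ n ⟧ x - x
    ≡⟨ closedForm-x≡RHS n x ⟩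
  RHS (suc n) x ∎
  where e = inv (cubic x)

cubicFactor-factorisation : ∀ x j →
  cubicFactor x j ≡ (x - ⟦ j ⟧) * (x * x + x * ⟦ j ⟧ + ⟦ j ⟧ * ⟦ j ⟧ - 1ℚ)
cubicFactor-factorisation x j =
  solve 2 (λ x J → x :* x :* x :- x :+ J :- J :* J :* J
                := (x :- J) :* (x :* x :+ x :* J :+ J :* J :- con 1ℚ))
    refl x ⟦ j ⟧

cubicFactor-⟦⟧≢0 : ∀ {n j} → j < n → 1 < n → cubicFactor ⟦ n ⟧ j ≢ 0ℚ
cubicFactor-⟦⟧≢0 {n@(suc _)} {j} j<n 1<n =
  subst (_≢ 0ℚ) (sym (cubicFactor-factorisation ⟦ n ⟧ j)) (*-≢0 first≢0 second≢0)
  where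
  s = n ℕ.* n ℕ.+ n ℕ.* j ℕ.+ j ℕ.* j
  1<s : 1 < s
  1<s = ℕP.<-≤-trans 1<n (ℕP.≤-trans (ℕP.m≤m*n n n) (ℕP.≤-trans
          (ℕP.m≤m+n (n ℕ.* n) (n ℕ.* j)) (ℕP.m≤m+n (n ℕ.* n ℕ.+ n ℕ.* j) (j ℕ.* j))))
  ⟦s⟧ : ⟦ s ⟧ ≡ ⟦ n ⟧ * ⟦ n ⟧ + ⟦ n ⟧ * ⟦ j ⟧ + ⟦ j ⟧ * ⟦ j ⟧
  ⟦s⟧ = begin
    ⟦ n ℕ.* n ℕ.+ n ℕ.* j ℕ.+ j ℕ.* j ⟧
      ≡⟨ ⟦⟧-homo-+ (n ℕ.* n ℕ.+ n ℕ.* j) (j ℕ.* j) ⟩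
    ⟦ n ℕ.* n ℕ.+ n ℕ.* j ⟧ + ⟦ j ℕ.* j ⟧
      ≡⟨ cong (_+ ⟦ j ℕ.* j ⟧) (⟦⟧-homo-+ (n ℕ.* n) (n ℕ.* j)) ⟩
    ⟦ n ℕ.* n ⟧ + ⟦ n ℕ.* j ⟧ + ⟦ j ℕ.* j ⟧
      ≡⟨ cong₂ (λ a b → a + b + ⟦ j ℕ.* j ⟧) (⟦⟧-homo-* n n) (⟦⟧-homo-* n j) ⟩
    ⟦ n ⟧ * ⟦ n ⟧ + ⟦ n ⟧ * ⟦ j ⟧ + ⟦ j ℕ.* j ⟧
      ≡⟨ cong (_+_ (⟦ n ⟧ * ⟦ n ⟧ + ⟦ n ⟧ * ⟦ j ⟧)) (⟦⟧-homo-* j j) ⟩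
    ⟦ n ⟧ * ⟦ n ⟧ + ⟦ n ⟧ * ⟦ j ⟧ + ⟦ j ⟧ * ⟦ j ⟧ ∎
  first≢0 : ⟦ n ⟧ - ⟦ j ⟧ ≢ 0ℚ
  first≢0 = ⟦m⟧-⟦n⟧≢0 (ℕP.>⇒≢ j<n)
  second≢0 : ⟦ n ⟧ * ⟦ n ⟧ + ⟦ n ⟧ * ⟦ j ⟧ + ⟦ j ⟧ * ⟦ j ⟧ - 1ℚ ≢ 0ℚ
  second≢0 = subst (λ q → q - 1ℚ ≢ 0ℚ) ⟦s⟧ (⟦m⟧-⟦n⟧≢0 (ℕP.>⇒≢ 1<s))

cubic≡cubicFactor-0 : ∀ x → cubic x ≡ cubicFactor x 0
cubic≡cubicFactor-0 x =
  solve 1 (λ x → cubicᴾ x := x :* x :* x :- x :+ con 0ℚ :- con 0ℚ :* con 0ℚ :* con 0ℚ) refl x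

∈-range1⇒< : ∀ {p j} → j ∈ range1 p → j < p
∈-range1⇒< {suc n} j∈ with _ , i<n , refl ← ∈-applyUpTo⁻ suc j∈ = s≤s i<n

RHS-diagonal : ∀ p → cubic ⟦ p ⟧ ≢ 0ℚ → RHS p ⟦ p ⟧ ≡ - ⟦ p ⟧
RHS-diagonal p cp≢0 = begin
  RHS p P
    ≡⟨ solve 2 (λ P e →
           P :* (P :- con 1ℚ) :* (con ⟦ 3 ⟧ :* P :* P :- con ⟦ 4 ⟧ :* P :* P :- con ⟦ 3 ⟧ :* P :+ con ⟦ 2 ⟧ :* P) :* e
         := (:- P) :* (e :* cubicᴾ P))
         refl P (inv (cubic P)) ⟩
  - P * (inv (cubic P) * cubic P)  ≡⟨ cong (- P *_) (inv-inverseˡ (cubic P) cp≢0) ⟩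
  - P * 1ℚ                         ≡⟨ ℚP.*-identityʳ (- P) ⟩
  - P                              ∎
  where P = ⟦ p ⟧

A-diagonal : ∀ p → 1 < p → A p ⟦ p ⟧ ≡ - ⟦ p ⟧
A-diagonal p@(suc n) 1<p =
  trans (A≡RHS n ⟦ p ⟧ cp≢0 (λ j j∈ → cubicFactor-⟦⟧≢0 (∈-range1⇒< j∈) 1<p)) (RHS-diagonal p cp≢0)
  where
  cp≢0 : cubic ⟦ p ⟧ ≢ 0ℚ
  cp≢0 = subst (_≢ 0ℚ) (sym (cubic≡cubicFactor-0 ⟦ p ⟧)) (cubicFactor-⟦⟧≢0 (s≤s z≤n) 1<p)

mainTheorem2 : (p : ℕ) → p ≥ 2 →
    ((x : ℚ) → x * (x - 1ℚ) * (x + 1ℚ) ≢ 0ℚ →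
      ((j : ℕ) → j ∈ range1 p → cubicFactor x j ≢ 0ℚ) →
      A p x ≡ RHS p x)
    × (A p ⟦ p ⟧ ≡ - ⟦ p ⟧)
mainTheorem2 p@(suc n) 1<p = A≡RHS n , A-diagonal p 1<p
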